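{- Let $\mathcal{H}$ be a finite family of digraphs, $h=\max_{H\in\mathcal{H}}|V(H)|$, and let $p$ be the length of some directed path $P\in\mathcal{H}$. If $H^*\in\mathcal{H}^-_p$, then $|V(H^*)|\le h+(p-1)h^2$.
   Context: For a digraph $H$, $GPC(H)$ (good path completions) consists of all strongly connected digraphs of the form $H\cup P_1\cup\dots\cup P_\ell$, where each $P_i$ is a directed path with both end-points in $V(H)$ (paths not necessarily disjoint), no two of the paths having the same ordered pair of end-points; $\{P_1,\dots,P_\ell\}$ is a witnessing collection of paths. $GPC(\mathcal{H})=\bigcup_{H\in\mathcal{H}}GPC(H)$. $\mathcal{H}^-_p$ is the set of digraphs in $GPC(\mathcal{H})$ that have some witnessing collection of paths in which every path has length at most $p-1$; $\mathcal{H}^+_p=GPC(\mathcal{H})\setminus\mathcal{H}^-_p$. Length of a path is its number of arcs. -}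

module Defs where

open import Data.Nat using (ℕ; zero; suc; _≤_; _⊔_)
open import Data.Fin using (Fin; toℕ)
open import Data.Bool using (Bool; true; false)
open import Data.List using (List; []; _∷_; _++_; length)
open import Data.List.Membership.Propositional using (_∈_)
open import Data.List.Relation.Unary.All using (All)
open import Data.List.Relation.Unary.Any using (Any)
open import Data.List.Relation.Unary.AllPairs using (AllPairs)
open import Data.List.Relation.Unary.Unique.Propositional using (Unique)
open import Data.List.Relation.Unary.Linked using (Linked)
open import Data.Product using (Σ; ∃; ∃-syntax; _×_; _,_)
open import Data.Sum using (_⊎_)
open import Relation.Binary.PropositionalEquality using (_≡_)
open import Relation.Nullary using (¬_)
open import Function.Bundles using (_⤖_; Bijection)

record Digraph : Set where
  field
    n     : ℕ
    arc   : Fin n → Fin n → Bool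
    loopless : ∀ i → arc i i ≡ false
open Digraph public

Arc : (G : Digraph) → Fin (n G) → Fin (n G) → Set
Arc G u v = arc G u v ≡ true

data Reach (G : Digraph) : Fin (n G) → Fin (n G) → Set where
  here  : ∀ {u} → Reach G u u
  there : ∀ {u v w} → Arc G u v → Reach G v w → Reach G u w

StronglyConnected : Digraph → Set
StronglyConnected G = ∀ u v → Reach G u v

-- G is (isomorphic to) the directed path of length p (p arcs, p+1 vertices).
IsDirectedPath : Digraph → ℕ → Set
IsDirectedPath G p =
  Σ (Fin (n G) ⤖ Fin (suc p)) λ f →
    ∀ i j → (Arc G i j → suc (toℕ (Bijection.to f i)) ≡ toℕ (Bijection.to f j))
          × (suc (toℕ (Bijection.to f i)) ≡ toℕ (Bijection.to f j) → Arc G i j)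

lastOf : {A : Set} → A → List A → A
lastOf x []       = x
lastOf x (y ∷ ys) = lastOf y ys

record DPath (G : Digraph) : Set where
  field
    start    : Fin (n G)
    rest     : List (Fin (n G))
    distinct : Unique (start ∷ rest)
    arcs     : Linked (Arc G) (start ∷ rest)
open DPath public

verts : ∀ {G} → DPath G → List (Fin (n G))
verts P = start P ∷ rest P

finish : ∀ {G} → DPath G → Fin (n G)
finish P = lastOf (start P) (rest P)

len : ∀ {G} → DPath G → ℕ
len P = length (rest P)

ArcOnPath : {A : Set} → A → A → List A → Set
ArcOnPath {A} u v xs = Σ (List A) λ ys → Σ (List A) λ zs → xs ≡ ys ++ (u ∷ v ∷ zs)

-- G = H ∪ P₁ ∪ … ∪ Pℓ : H is a subgraph of G via the injective, arc-preserving map φ,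
-- the Pᵢ are directed paths in G with both end-points in φ(V(H)), no two with the same
-- ordered pair of end-points, and every vertex / arc of G lies in H or on some Pᵢ.
record PathCompletion (H G : Digraph) : Set where
  field
    φ        : Fin (n H) → Fin (n G)
    φ-inj    : ∀ i j → φ i ≡ φ j → i ≡ j
    φ-arc    : ∀ i j → Arc H i j → Arc G (φ i) (φ j)
    paths    : List (DPath G)
    start∈H  : All (λ P → ∃[ i ] φ i ≡ start P) paths
    finish∈H : All (λ P → ∃[ i ] φ i ≡ finish P) paths
    distinctEnds : AllPairs (λ P Q → ¬ (start P ≡ start Q × finish P ≡ finish Q)) paths
    coverV   : ∀ v → (∃[ i ] φ i ≡ v) ⊎ Any (λ P → v ∈ verts P) paths
    coverA   : ∀ u v → Arc G u v →
               (∃[ i ] ∃[ j ] (φ i ≡ u × φ j ≡ v × Arc H i j))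
               ⊎ Any (λ P → ArcOnPath u v (verts P)) paths
open PathCompletion public

GPC : Digraph → Digraph → Set
GPC H G = StronglyConnected G × PathCompletion H G

InHminus : List Digraph → ℕ → Digraph → Set
InHminus 𝓗 p G =
  StronglyConnected G ×
  Σ Digraph λ H → H ∈ 𝓗 ×
    Σ (PathCompletion H G) λ w → All (λ P → suc (len P) ≤ p) (paths w)

maxOrder : List Digraph → ℕ
maxOrder []       = 0
maxOrder (G ∷ Gs) = n G ⊔ maxOrder Gs

-- Every vertex of H* is the image of a vertex of H or lies after the start on one of the
-- witnessing paths. The paths have pairwise distinct ordered pairs of end-points in H, so
-- there are at most |V(H)|² of them, and each contributes at most p - 1 vertices besides
-- its start.
module Submission where

open import Defs
open import Data.Nat using (ℕ; _≤_; _+_; _*_; _∸_; suc; z≤n)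
open import Data.Nat.Properties
  using (≤-trans; m≤m⊔n; m≤n⊔m; +-mono-≤; +-monoʳ-≤; *-mono-≤; *-monoʳ-≤; *-suc; ∸-monoˡ-≤;
         module ≤-Reasoning)
open import Data.List using (List; _∷_; _++_; length; lookup; tabulate; concatMap)
open import Data.List.Properties using (length-++; length-tabulate)
open import Data.List.Membership.Propositional using (_∈_)
open import Data.List.Membership.Propositional.Properties
  using (∈-lookup; ∈-tabulate⁺; ∈-++⁺ˡ; ∈-++⁺ʳ; ∈-concatMap⁺)
open import Data.List.Membership.Setoid.Properties using (index-injective)
open import Data.List.Relation.Unary.All as All using (All; []; _∷_)
open import Data.List.Relation.Unary.Any using (Any; here; there)
open import Data.List.Relation.Unary.AllPairs using (AllPairs; []; _∷_)
open import Data.Fin using (Fin; combine) renaming (zero to fzero; suc to fsuc)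
open import Data.Fin.Properties using (injective⇒≤; combine-injective)
open import Data.Product using (Σ; _×_; _,_; proj₁; proj₂)
open import Data.Sum as Sum using (_⊎_; inj₁; inj₂)
open import Data.Empty using (⊥-elim)
open import Relation.Nullary using (¬_)
open import Relation.Binary.PropositionalEquality using (_≡_; refl; sym; trans; cong; setoid)

covers⇒≤length : ∀ {m} (xs : List (Fin m)) → (∀ v → v ∈ xs) → m ≤ length xs
covers⇒≤length xs covers =
  injective⇒≤ (λ {u} {v} → index-injective (setoid _) (covers u) (covers v))

AllPairs-lookup : ∀ {A : Set} {R : A → A → Set} {xs : List A} → AllPairs R xs →
                  (k l : Fin (length xs)) →
                  k ≡ l ⊎ R (lookup xs k) (lookup xs l) ⊎ R (lookup xs l) (lookup xs k)
AllPairs-lookup (_ ∷ _)  fzero    fzero    = inj₁ refl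
AllPairs-lookup (rx ∷ _) fzero    (fsuc l) = inj₂ (inj₁ (All.lookup rx (∈-lookup l)))
AllPairs-lookup (rx ∷ _) (fsuc k) fzero    = inj₂ (inj₂ (All.lookup rx (∈-lookup k)))
AllPairs-lookup (_ ∷ rs) (fsuc k) (fsuc l) with AllPairs-lookup rs k l
... | inj₁ refl = inj₁ refl
... | inj₂ r    = inj₂ r

AllPairs⇒length≤ : ∀ {A : Set} {R : A → A → Set} {xs : List A} {m} → AllPairs R xs →
                   (code : Fin (length xs) → Fin m) →
                   (∀ k l → code k ≡ code l → ¬ R (lookup xs k) (lookup xs l)) →
                   length xs ≤ m
AllPairs⇒length≤ rs code clash = injective⇒≤ code-injective
  where
  code-injective : ∀ {k l} → code k ≡ code l → k ≡ l
  code-injective {k} {l} eq with AllPairs-lookup rs k l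
  ... | inj₁ k≡l        = k≡l
  ... | inj₂ (inj₁ rkl) = ⊥-elim (clash k l eq rkl)
  ... | inj₂ (inj₂ rlk) = ⊥-elim (clash l k (sym eq) rlk)

length-concatMap≤ : ∀ {A B : Set} {f : A → List B} {c} {xs : List A} →
                    All (λ x → length (f x) ≤ c) xs → length (concatMap f xs) ≤ c * length xs
length-concatMap≤ [] = z≤n
length-concatMap≤ {f = f} {c} {x ∷ xs} (fx≤c ∷ rest≤c) = begin
  length (f x ++ concatMap f xs)         ≡⟨ length-++ (f x) ⟩
  length (f x) + length (concatMap f xs) ≤⟨ +-mono-≤ fx≤c (length-concatMap≤ rest≤c) ⟩
  c + c * length xs                      ≡⟨ sym (*-suc c (length xs)) ⟩
  c * suc (length xs)                    ∎
  where open ≤-Reasoning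

n≤maxOrder : ∀ {H 𝓗} → H ∈ 𝓗 → n H ≤ maxOrder 𝓗
n≤maxOrder {𝓗 = G ∷ Gs} (here refl) = m≤m⊔n (n G) (maxOrder Gs)
n≤maxOrder {𝓗 = G ∷ Gs} (there H∈) = ≤-trans (n≤maxOrder H∈) (m≤n⊔m (n G) (maxOrder Gs))

Any-∈-verts⁻ : ∀ {G v} {Ps : List (DPath G)} → Any (λ P → v ∈ verts P) Ps →
               Any (λ P → v ≡ start P) Ps ⊎ Any (λ P → v ∈ rest P) Ps
Any-∈-verts⁻ (here (here v≡s))  = inj₁ (here v≡s)
Any-∈-verts⁻ (here (there v∈r)) = inj₂ (here v∈r)
Any-∈-verts⁻ (there v∈Ps)       = Sum.map there there (Any-∈-verts⁻ v∈Ps)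

module _ {H G : Digraph} (w : PathCompletion H G) where

  hostVertices : List (Fin (n G))
  hostVertices = tabulate (φ w) ++ concatMap rest (paths w)

  length-hostVertices : length hostVertices ≡ n H + length (concatMap rest (paths w))
  length-hostVertices = trans (length-++ (tabulate (φ w)))
                              (cong (_+ length (concatMap rest (paths w))) (length-tabulate (φ w)))

  image∈hostVertices : ∀ {i v} → φ w i ≡ v → v ∈ hostVertices
  image∈hostVertices {i} refl = ∈-++⁺ˡ (∈-tabulate⁺ i)

  ∈-hostVertices : ∀ v → v ∈ hostVertices
  ∈-hostVertices v with coverV w v
  ... | inj₁ (_ , φi≡v) = image∈hostVertices φi≡v
  ... | inj₂ v∈path with Any-∈-verts⁻ v∈path
  ...   | inj₂ v∈rest  = ∈-++⁺ʳ (tabulate (φ w)) (∈-concatMap⁺ rest v∈rest)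
  ...   | inj₁ v≡start with All.lookupAny (start∈H w) v≡start
  ...     | (_ , φi≡s) , v≡s = image∈hostVertices (trans φi≡s (sym v≡s))

  length-paths≤ : length (paths w) ≤ n H * n H
  length-paths≤ = AllPairs⇒length≤ (distinctEnds w) endpointCode sameEnds
    where
    startOf : (k : Fin (length (paths w))) → Σ (Fin (n H)) λ i → φ w i ≡ start (lookup (paths w) k)
    startOf k = All.lookup (start∈H w) (∈-lookup k)
    finishOf : (k : Fin (length (paths w))) → Σ (Fin (n H)) λ i → φ w i ≡ finish (lookup (paths w) k)
    finishOf k = All.lookup (finish∈H w) (∈-lookup k)

    endpointCode : Fin (length (paths w)) → Fin (n H * n H)
    endpointCode k = combine (proj₁ (startOf k)) (proj₁ (finishOf k))

    sameImage : ∀ {i j u v} → φ w i ≡ u → φ w j ≡ v → i ≡ j → u ≡ v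
    sameImage φi≡u φj≡v refl = trans (sym φi≡u) φj≡v

    sameEnds : ∀ k l → endpointCode k ≡ endpointCode l →
               ¬ ¬ (start (lookup (paths w) k) ≡ start (lookup (paths w) l)
                    × finish (lookup (paths w) k) ≡ finish (lookup (paths w) l))
    sameEnds k l eq different with combine-injective _ _ _ _ eq
    ... | sameStart , sameFinish =
      different ( sameImage (proj₂ (startOf k)) (proj₂ (startOf l)) sameStart
                , sameImage (proj₂ (finishOf k)) (proj₂ (finishOf l)) sameFinish )

lemma21 : (𝓗 : List Digraph) (p : ℕ) →
            Σ Digraph (λ P → P ∈ 𝓗 × IsDirectedPath P p) →
            (H* : Digraph) → InHminus 𝓗 p H* →
            n H* ≤ maxOrder 𝓗 + (p ∸ 1) * (maxOrder 𝓗 * maxOrder 𝓗)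
lemma21 𝓗 p _ H* (_ , H , H∈𝓗 , w , short) = begin
  n H*                                               ≤⟨ covers⇒≤length (hostVertices w) (∈-hostVertices w) ⟩
  length (hostVertices w)                            ≡⟨ length-hostVertices w ⟩
  n H + length (concatMap rest (paths w))            ≤⟨ +-monoʳ-≤ (n H) (length-concatMap≤ (All.map (∸-monoˡ-≤ 1) short)) ⟩
  n H + (p ∸ 1) * length (paths w)                   ≤⟨ +-mono-≤ n≤h (*-monoʳ-≤ (p ∸ 1) (≤-trans (length-paths≤ w) (*-mono-≤ n≤h n≤h))) ⟩
  maxOrder 𝓗 + (p ∸ 1) * (maxOrder 𝓗 * maxOrder 𝓗) ∎
  where
  open ≤-Reasoning
  n≤h : n H ≤ maxOrder 𝓗
  n≤h = n≤maxOrder H∈𝓗
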